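{- Let $q\ge2$, $M>m\ge0$ and $\ell\le u$ be integers, and set \[\ell'=\Big\lfloor\frac{(\ell+1)q^{M-m}-q^M}{q^{M-m}-1}\Big\rfloor[\ell<0],\qquad u'=q^m-1+\Big\lceil\frac{uq^{M-m}}{q^{M-m}-1}\Big\rceil[u>0].\] Let $d$ be an integer with $\ell'\le d\le q^{M-1}-q^m+u'$ and write $d=d'q^M+r'$ with $d'\in\mathbb{Z}$ and $0\le r'<q^M$. Then $\ell'\le q^md'+\ell$ and $q^md'+u\le u'$. If in addition $r'\ge q^{M-1}$, then $q^md'+q^m+u\le u'$.
   Context: $[S]$ denotes the Iverson bracket ($1$ if $S$ is true, $0$ otherwise). -}

module Defs where

open import Data.Nat as ℕ using (ℕ; zero; suc; _^_; _∸_)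
open import Data.Integer using (ℤ; +_; -_; _*_; _+_; _-_; _<?_; 0ℤ; _/_)
open import Relation.Nullary.Decidable using (does)
open import Data.Bool using (Bool; if_then_else_)

-- For b > 0, ℤ's _/_ is Euclidean
-- division (remainder in [0,b)), i.e. floor division.  The value for b = 0
-- is a junk value (0) that never occurs in the statement (q ≥ 2, M > m).
⌊_/_⌋ : ℤ → ℕ → ℤ
⌊ a / zero ⌋ = 0ℤ
⌊ a / suc b ⌋ = a / (+ suc b)

⌈_/_⌉ : ℤ → ℕ → ℤ
⌈ a / b ⌉ = - ⌊ (- a) / b ⌋

[_] : Bool → ℤ
[ b ] = if b then + 1 else 0ℤ

ℓ′ : (q M m : ℕ) → ℤ → ℤ
ℓ′ q M m ℓ = ⌊ (ℓ + + 1) * + (q ^ (M ∸ m)) - + (q ^ M) / q ^ (M ∸ m) ∸ 1 ⌋ * [ does (ℓ <? 0ℤ) ]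

u′ : (q M m : ℕ) → ℤ → ℤ
u′ q M m u = + (q ^ m) - + 1 + ⌈ u * + (q ^ (M ∸ m)) / q ^ (M ∸ m) ∸ 1 ⌉ * [ does (0ℤ <? u) ]

{-# OPTIONS --safe #-}
-- Put P = q^m and Q = q^(M-m) = N + 1, so that q^M = P Q and d = (P d′) Q + r′.
-- The floor in ℓ′ gives ℓ′ N ≤ (ℓ + 1) Q - P Q, and the ceiling c in u′ = P - 1 + c
-- gives u Q ≤ c N.  Adding these to the bounds on d makes the N-multiples combine
-- with the rest into a strict inequality X Q < Y Q, whence X < Y is the claim.
-- For ℓ ≥ 0 instead ℓ′ = 0, and 0 ≤ d < (d′ + 1) q^M forces d′ ≥ 0.
module Submission where

open import Defs
open import Data.Nat as ℕ using (ℕ; _^_; _∸_; suc; s≤s)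
import Data.Nat.Properties as ℕ
open import Data.Integer
  using (ℤ; +_; _*_; _+_; _-_; -_; _≤_; _<_; 0ℤ; 1ℤ; -1ℤ; +≤+; +<+)
  renaming (suc to sucℤ)
open import Data.Integer.Properties
open import Data.Integer.DivMod using (_/_; _%_; a≡a%n+[a/n]*n)
open import Data.Integer.Tactic.RingSolver using (solve-∀)
open import Function using (_∘_)
open import Data.Product using (_×_; _,_; ∃-syntax; proj₁; proj₂)
open import Relation.Nullary using (yes; no)
open import Relation.Nullary.Decidable using (does; dec-true; dec-false)
open import Relation.Binary.PropositionalEquality
  using (_≡_; refl; sym; trans; cong; subst; subst₂)

≥2⇒≡suc-suc : ∀ {n} → 2 ℕ.≤ n → ∃[ k ] n ≡ suc (suc k)
≥2⇒≡suc-suc (s≤s (s≤s {n = k} _)) = k , refl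

+-cancelʳ-< : ∀ {i j} k → i + k < j + k → i < j
+-cancelʳ-< {i} {j} k = subst₂ _<_ (cancel i k) (cancel j k) ∘ +-monoˡ-< (- k)
  where
  cancel : ∀ a b → a + b - b ≡ a
  cancel = solve-∀

i<suc[j]⇒i≤j : ∀ {i j} → i < sucℤ j → i ≤ j
i<suc[j]⇒i≤j {i} {j} i<1+j = subst (i ≤_) (pred-suc j) (i<j⇒i≤pred[j] i<1+j)

floor-mul-≤ : ∀ a n → ⌊ a / suc n ⌋ * + suc n ≤ a
floor-mul-≤ a n = begin
  ⌊ a / suc n ⌋ * + suc n                  ≤⟨ i≤j+i _ (+ (a % + suc n)) ⟩
  + (a % + suc n) + a / + suc n * + suc n  ≡⟨ sym (a≡a%n+[a/n]*n a (+ suc n)) ⟩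
  a                                        ∎
  where open ≤-Reasoning

ceil-mul-≥ : ∀ a n → a ≤ ⌈ a / suc n ⌉ * + suc n
ceil-mul-≥ a n = begin
  a                              ≡⟨ sym (neg-involutive a) ⟩
  - - a                          ≤⟨ neg-mono-≤ (floor-mul-≤ (- a) n) ⟩
  - (⌊ - a / suc n ⌋ * + suc n)  ≡⟨ neg-distribˡ-* ⌊ - a / suc n ⌋ (+ suc n) ⟩
  ⌈ a / suc n ⌉ * + suc n        ∎
  where open ≤-Reasoning

ℓ′-mul-≤ : ∀ q M m {ℓ n} → q ^ (M ∸ m) ≡ suc (suc n) → ℓ < 0ℤ →
  ℓ′ q M m ℓ * + suc n ≤ (ℓ + 1ℤ) * + suc (suc n) - + q ^ M
ℓ′-mul-≤ q M m {ℓ} {n} Q≡ ℓ<0 = go (q ^ (M ∸ m)) Q≡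
  where
  go : ∀ Q → Q ≡ suc (suc n) →
    ⌊ (ℓ + 1ℤ) * + Q - + q ^ M / Q ∸ 1 ⌋ * [ does (ℓ <? 0ℤ) ] * + suc n
      ≤ (ℓ + 1ℤ) * + suc (suc n) - + q ^ M
  go _ refl rewrite dec-true (ℓ <? 0ℤ) ℓ<0
                  | *-identityʳ ⌊ (ℓ + 1ℤ) * + suc (suc n) - + q ^ M / suc n ⌋ = floor-mul-≤ _ n

ℓ′≡0 : ∀ q M m {ℓ} → 0ℤ ≤ ℓ → ℓ′ q M m ℓ ≡ 0ℤ
ℓ′≡0 q M m {ℓ} 0≤ℓ rewrite dec-false (ℓ <? 0ℤ) (≤⇒≯ 0≤ℓ) =
  *-zeroʳ ⌊ (ℓ + 1ℤ) * + q ^ (M ∸ m) - + q ^ M / q ^ (M ∸ m) ∸ 1 ⌋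

-- u′ q M m u unfolds to + q ^ m - 1ℤ + ⌈u′⌉ q M m u.
⌈u′⌉ : (q M m : ℕ) → ℤ → ℤ
⌈u′⌉ q M m u = ⌈ u * + (q ^ (M ∸ m)) / q ^ (M ∸ m) ∸ 1 ⌉ * [ does (0ℤ <? u) ]

⌈u′⌉-mul-≥ : ∀ q M m u {n} → q ^ (M ∸ m) ≡ suc (suc n) →
  u * + suc (suc n) ≤ ⌈u′⌉ q M m u * + suc n
⌈u′⌉-mul-≥ q M m u {n} Q≡ = go (q ^ (M ∸ m)) Q≡
  where
  go : ∀ Q → Q ≡ suc (suc n) →
    u * + suc (suc n) ≤ ⌈ u * + Q / Q ∸ 1 ⌉ * [ does (0ℤ <? u) ] * + suc n
  go _ refl with 0ℤ <? u
  ... | yes _ rewrite *-identityʳ ⌈ u * + suc (suc n) / suc n ⌉ = ceil-mul-≥ _ n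
  ... | no u≯0 rewrite *-zeroʳ ⌈ u * + suc (suc n) / suc n ⌉ =
    *-monoʳ-≤-nonNeg (+ suc (suc n)) (≮⇒≥ u≯0)

0≤quotient : ∀ {d′ r B} → 0ℤ ≤ d′ * + B + + r → r ℕ.< B → 0ℤ ≤ d′
0≤quotient {d′} {r} {B} 0≤d r<B = i<suc[j]⇒i≤j (*-cancelʳ-<-nonNeg (+ B) (begin-strict
  0ℤ * + B           ≡⟨ *-zeroˡ (+ B) ⟩
  0ℤ                 ≤⟨ 0≤d ⟩
  d′ * + B + + r     <⟨ +-monoʳ-< (d′ * + B) (+<+ r<B) ⟩
  d′ * + B + + B     ≡⟨ regroup d′ (+ B) ⟩
  sucℤ d′ * + B      ∎))
  where
  open ≤-Reasoning
  regroup : ∀ a b → a * b + b ≡ (1ℤ + a) * b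
  regroup = solve-∀

lower-bound-by-scaling : ∀ {L x ℓ B} n →
  L * + n ≤ (ℓ + 1ℤ) * + suc n - B → L < x * + suc n + B → L ≤ x + ℓ
lower-bound-by-scaling {L} {x} {ℓ} {B} n Ln≤ L< =
  i<suc[j]⇒i≤j (*-cancelʳ-<-nonNeg (+ suc n) (begin-strict
  L * + suc n                                 ≡⟨ split L (+ n) ⟩
  L * + n + L                                 <⟨ +-mono-≤-< Ln≤ L< ⟩
  (ℓ + 1ℤ) * + suc n - B + (x * + suc n + B)  ≡⟨ regroup ℓ x B (+ n) ⟩
  sucℤ (x + ℓ) * + suc n                      ∎))
  where
  open ≤-Reasoning
  split : ∀ a N → a * (1ℤ + N) ≡ a * N + a
  split = solve-∀
  regroup : ∀ ℓ x B N →
    (ℓ + 1ℤ) * (1ℤ + N) - B + (x * (1ℤ + N) + B) ≡ (1ℤ + (x + ℓ)) * (1ℤ + N)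
  regroup = solve-∀

upper-bound-by-scaling : ∀ {x u c P} n →
  u * + suc n ≤ c * + n → x * + suc n < P * + suc n + c → x + u ≤ P - 1ℤ + c
upper-bound-by-scaling {x} {u} {c} {P} n uQ≤ xQ< =
  subst (x + u ≤_) (shift P c)
    (i<j⇒i≤pred[j] (*-cancelʳ-<-nonNeg {j = P + c} (+ suc n) (begin-strict
      (x + u) * + suc n          ≡⟨ *-distribʳ-+ (+ suc n) x u ⟩
      x * + suc n + u * + suc n  <⟨ +-mono-<-≤ xQ< uQ≤ ⟩
      P * + suc n + c + c * + n  ≡⟨ regroup P c (+ n) ⟩
      (P + c) * + suc n          ∎)))
  where
  open ≤-Reasoning
  regroup : ∀ P c N → P * (1ℤ + N) + c + c * N ≡ (P + c) * (1ℤ + N)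
  regroup = solve-∀
  shift : ∀ P c → -1ℤ + (P + c) ≡ P - 1ℤ + c
  shift = solve-∀

2≤m^n : ∀ {m n} → 2 ℕ.≤ m → 0 ℕ.< n → 2 ℕ.≤ m ^ n
2≤m^n {m@(suc _)} {n} 2≤m 0<n =
  ℕ.≤-trans 2≤m (subst (ℕ._≤ m ^ n) (ℕ.*-identityʳ m) (ℕ.^-monoʳ-≤ m 0<n))

^-split : ∀ q {m M} → m ℕ.≤ M → q ^ M ≡ q ^ m ℕ.* q ^ (M ∸ m)
^-split q {m} {M} m≤M =
  trans (cong (q ^_) (sym (ℕ.m+[n∸m]≡n m≤M))) (ℕ.^-distribˡ-+-* q m (M ∸ m))

module _ {q M m : ℕ} (2≤q : 2 ℕ.≤ q) (m<M : m ℕ.< M) where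
  private
    P T : ℤ
    P = + q ^ m
    T = + q ^ (M ∸ 1)

    Q-shape : ∃[ k ] q ^ (M ∸ m) ≡ suc (suc k)
    Q-shape = ≥2⇒≡suc-suc (2≤m^n 2≤q (ℕ.m<n⇒0<n∸m m<M))

    n : ℕ
    n = suc (proj₁ Q-shape)

    Q≡ : q ^ (M ∸ m) ≡ suc n
    Q≡ = proj₂ Q-shape

    Q : ℤ
    Q = + suc n

    qᴹ≡PQ : + q ^ M ≡ P * Q
    qᴹ≡PQ = trans (cong +_ (^-split q (ℕ.<⇒≤ m<M)))
                  (trans (pos-* (q ^ m) (q ^ (M ∸ m))) (cong (λ Q → P * + Q) Q≡))

    T≤PQ : T ≤ P * Q
    T≤PQ = subst (T ≤_) qᴹ≡PQ
      (+≤+ (ℕ.^-monoʳ-≤ q {{ℕ.>-nonZero (ℕ.<-≤-trans ℕ.z<s 2≤q)}} (ℕ.m∸n≤m M 1)))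

  module _ {d d′ : ℤ} {r′ : ℕ} (d≡ : d ≡ d′ * + q ^ M + + r′) (r′<qᴹ : r′ ℕ.< q ^ M)
    where
    private
      d≡PdQ+r : d ≡ P * d′ * Q + + r′
      d≡PdQ+r = trans d≡ (cong (_+ + r′) (trans (cong (d′ *_) qᴹ≡PQ) (reassoc d′ P Q)))
        where
        reassoc : ∀ a b c → a * (b * c) ≡ b * a * c
        reassoc = solve-∀

    ℓ′≤qᵐd′+ℓ : ∀ {ℓ} → ℓ′ q M m ℓ ≤ d → ℓ′ q M m ℓ ≤ P * d′ + ℓ
    ℓ′≤qᵐd′+ℓ {ℓ} ℓ′≤d with 0ℤ ≤? ℓ
    ... | no ℓ≱0 = lower-bound-by-scaling {x = P * d′} {B = + q ^ M} n
                     (ℓ′-mul-≤ q M m Q≡ (≰⇒> ℓ≱0)) (≤-<-trans ℓ′≤d d<PdQ+qᴹ)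
      where
      d<PdQ+qᴹ : d < P * d′ * Q + + q ^ M
      d<PdQ+qᴹ = subst (_< P * d′ * Q + + q ^ M) (sym d≡PdQ+r)
                   (+-monoʳ-< (P * d′ * Q) (+<+ r′<qᴹ))
    ... | yes 0≤ℓ = begin
      ℓ′ q M m ℓ      ≡⟨ ℓ′≡0 q M m 0≤ℓ ⟩
      0ℤ              ≡⟨ sym (trans (+-identityʳ (P * 0ℤ)) (*-zeroʳ P)) ⟩
      P * 0ℤ + 0ℤ     ≤⟨ +-mono-≤ (*-monoˡ-≤-nonNeg P 0≤d′) 0≤ℓ ⟩
      P * d′ + ℓ      ∎
      where
      open ≤-Reasoning
      0≤d′ : 0ℤ ≤ d′
      0≤d′ = 0≤quotient (subst₂ _≤_ (ℓ′≡0 q M m 0≤ℓ) d≡ ℓ′≤d) r′<qᴹ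

    module _ {u : ℤ} (d≤ : d ≤ T - P + u′ q M m u) where
      private
        c : ℤ
        c = ⌈u′⌉ q M m u

        d<T+c : d < T + c
        d<T+c = i≤pred[j]⇒i<j (subst (d ≤_) (cancel T P c) d≤)
          where
          cancel : ∀ T P c → T - P + (P - 1ℤ + c) ≡ -1ℤ + (T + c)
          cancel = solve-∀

      qᵐd′+u≤u′ : P * d′ + u ≤ u′ q M m u
      qᵐd′+u≤u′ = upper-bound-by-scaling {P * d′} {u} {c} {P} n (⌈u′⌉-mul-≥ q M m u Q≡)
        (begin-strict
          P * d′ * Q           ≤⟨ i≤i+j (P * d′ * Q) (+ r′) ⟩
          P * d′ * Q + + r′    ≡⟨ sym d≡PdQ+r ⟩
          d                    <⟨ d<T+c ⟩
          T + c                ≤⟨ +-monoˡ-≤ c T≤PQ ⟩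
          P * Q + c            ∎)
        where open ≤-Reasoning

      qᵐd′+qᵐ+u≤u′ : q ^ (M ∸ 1) ℕ.≤ r′ → P * d′ + P + u ≤ u′ q M m u
      qᵐd′+qᵐ+u≤u′ T≤r′ =
        upper-bound-by-scaling {P * d′ + P} {u} {c} {P} n (⌈u′⌉-mul-≥ q M m u Q≡)
        (+-cancelʳ-< T (begin-strict
          (P * d′ + P) * Q + T       ≡⟨ regroup (P * d′) P Q T ⟩
          P * d′ * Q + T + P * Q     ≤⟨ +-monoˡ-≤ (P * Q) (+-monoʳ-≤ (P * d′ * Q) (+≤+ T≤r′)) ⟩
          P * d′ * Q + + r′ + P * Q  ≡⟨ cong (_+ P * Q) (sym d≡PdQ+r) ⟩
          d + P * Q                  <⟨ +-monoˡ-< (P * Q) d<T+c ⟩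
          T + c + P * Q              ≡⟨ swap T c (P * Q) ⟩
          P * Q + c + T              ∎))
        where
        open ≤-Reasoning
        regroup : ∀ x P Q T → (x + P) * Q + T ≡ x * Q + T + P * Q
        regroup = solve-∀
        swap : ∀ T c B → T + c + B ≡ B + c + T
        swap = solve-∀

lemma8p1 : (q M m : ℕ) → 2 ℕ.≤ q → m ℕ.< M → (ℓ u : ℤ) → ℓ ≤ u →
    (d : ℤ) → ℓ′ q M m ℓ ≤ d → d ≤ + (q ^ (M ∸ 1)) - + (q ^ m) + u′ q M m u →
    (d′ : ℤ) (r′ : ℕ) → r′ ℕ.< q ^ M → d ≡ d′ * + (q ^ M) + + r′ →
    (ℓ′ q M m ℓ ≤ + (q ^ m) * d′ + ℓ × + (q ^ m) * d′ + u ≤ u′ q M m u)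
    × (q ^ (M ∸ 1) ℕ.≤ r′ → + (q ^ m) * d′ + + (q ^ m) + u ≤ u′ q M m u)
lemma8p1 q M m 2≤q m<M ℓ u _ d ℓ′≤d d≤ d′ r′ r′<qᴹ d≡ =
  ( ℓ′≤qᵐd′+ℓ 2≤q m<M d≡ r′<qᴹ ℓ′≤d
  , qᵐd′+u≤u′ 2≤q m<M d≡ r′<qᴹ d≤ )
  , qᵐd′+qᵐ+u≤u′ 2≤q m<M d≡ r′<qᴹ d≤
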